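{- There exists a finite sequence $\sigma$ of positive algebraic integers lying in $\mathbb{Q}(\sqrt5)$ such that more than half of the terms of $\sigma$ are irrational and $\nu(\sigma)=0$. Moreover, letting $\phi=\frac{1+\sqrt5}2$ be the golden ratio, for every $N>0$ there exists such a sequence containing all of the numbers $(1/\phi)^n$ for $1\le n\le N$.
   Context: For a finite sequence $(a_1,\dots,a_M)$ (repetitions allowed), $\nu(a_1,\dots,a_M)=\big(\sum a_i\big)^2-\sum a_i^3$. -}

module Defs where

open import Data.Integer using (ℤ; +_; -[1+_]; _<_; _≤_; _*_; _-_) renaming (_+_ to _+ℤ_)
open import Data.Nat using (ℕ; zero; suc)
open import Data.List using (List; []; _∷_; foldr; map; length)
open import Data.Product using (_×_; _,_)
open import Relation.Binary.PropositionalEquality using (_≡_; _≢_)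
open import Relation.Nullary using (¬_; yes; no)
import Data.Integer as ℤ

-- The ring of algebraic integers of ℚ(√5) is ℤ[φ], φ = (1+√5)/2, φ² = φ + 1.
-- An element  a + b·φ  is represented by the pair (a , b).
record Zφ : Set where
  constructor mk
  field
    re : ℤ
    im : ℤ
open Zφ public

0φ : Zφ
0φ = mk (+ 0) (+ 0)

1φ : Zφ
1φ = mk (+ 1) (+ 0)

_⊕_ : Zφ → Zφ → Zφ
mk a b ⊕ mk c d = mk (a +ℤ c) (b +ℤ d)

_⊖_ : Zφ → Zφ → Zφ
mk a b ⊖ mk c d = mk (a - c) (b - d)

_⊗_ : Zφ → Zφ → Zφ
mk a b ⊗ mk c d = mk (a * c +ℤ b * d) (a * d +ℤ b * c +ℤ b * d)

_^φ_ : Zφ → ℕ → Zφ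
x ^φ zero = 1φ
x ^φ suc n = x ⊗ (x ^φ n)

-- 1/φ = φ - 1
invφ : Zφ
invφ = mk (-[1+ 0 ]) (+ 1)

-- Positivity of a + bφ as a real number (real embedding with √5 > 0).
-- a + bφ = (x + b√5)/2 with x = 2a + b; x + b√5 > 0 is decided by cases.
data Positive : Zφ → Set where
  pos-nonneg : ∀ {a b} → + 0 ≤ (+ 2) * a +ℤ b → + 0 ≤ b →
               ¬ ((+ 2) * a +ℤ b ≡ + 0 × b ≡ + 0) → Positive (mk a b)
  pos-bneg   : ∀ {a b} → + 0 < (+ 2) * a +ℤ b → b < + 0 →
               (+ 5) * (b * b) < ((+ 2) * a +ℤ b) * ((+ 2) * a +ℤ b) → Positive (mk a b)
  pos-xneg   : ∀ {a b} → (+ 2) * a +ℤ b < + 0 → + 0 < b →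
               ((+ 2) * a +ℤ b) * ((+ 2) * a +ℤ b) < (+ 5) * (b * b) → Positive (mk a b)

Irrational : Zφ → Set
Irrational x = im x ≢ + 0

irrCount : List Zφ → ℕ
irrCount [] = 0
irrCount (x ∷ xs) with im x ℤ.≟ + 0
... | yes _ = irrCount xs
... | no _  = suc (irrCount xs)

sumφ : List Zφ → Zφ
sumφ = foldr _⊕_ 0φ

ν : List Zφ → Zφ
ν σ = (sumφ σ ⊗ sumφ σ) ⊖ sumφ (map (λ a → a ⊗ (a ⊗ a)) σ)

{-# OPTIONS --safe #-}
-- ν σ = 0 says (Σ a)² = Σ a³.  Both sides are multiplicative for the sequence of all pairwise
-- products of two sequences, so every power of one sequence with this property keeps it; we
-- take (φ⁻¹, 1, 2φ⁻¹, 3φ⁻¹, 3, 5).  Its m-th power has 6^m terms, all of the form k φ⁻ʲ with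
-- k ≥ 1, hence positive, and only the 3^m products of 1, 3, 5 are rational, so for m ≥ 2 the
-- irrational terms are a majority; φ⁻ⁿ = (φ⁻¹)ⁿ · 1^(m−n) occurs for every n ≤ m.
module Submission where

open import Defs
open import Algebra.Bundles using (CommutativeSemigroup)
open import Data.Empty using (⊥-elim)
open import Data.Integer as ℤ using (ℤ; +_; 1ℤ; -1ℤ; +<+; -<+)
import Data.Integer.Properties as ℤₚ
open import Data.Integer.Tactic.RingSolver using (solve-∀)
open import Data.List using (List; []; _∷_; _++_; map; length; cartesianProductWith)
open import Data.List.Properties using (map-++; map-∘; map-cong; length-++; length-map)
open import Data.List.Membership.Propositional using (_∈_)
open import Data.List.Membership.Propositional.Properties
  using (∈-map⁺; ∈-cartesianProductWith⁺)
open import Data.List.Relation.Unary.All using (All; universal)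
open import Data.List.Relation.Unary.All.Properties using (map⁺)
open import Data.List.Relation.Unary.Any using (here; there)
open import Data.Nat using (ℕ; zero; suc; _+_; _*_; _^_; _<_; _≤_; z≤n; s≤s)
import Data.Nat.Properties as ℕₚ
import Data.Nat.Tactic.RingSolver as ℕ-Solver
open import Data.Product using (Σ; _×_; _,_)
open import Data.Sum using (_⊎_; inj₁; inj₂)
open import Relation.Binary.PropositionalEquality
open import Relation.Nullary using (yes; no)

⊕-identityˡ : ∀ x → 0φ ⊕ x ≡ x
⊕-identityˡ (mk a b) = cong₂ mk (ℤₚ.+-identityˡ a) (ℤₚ.+-identityˡ b)

⊕-assoc : ∀ x y z → (x ⊕ y) ⊕ z ≡ x ⊕ (y ⊕ z)
⊕-assoc (mk a b) (mk c d) (mk e f) = cong₂ mk (ℤₚ.+-assoc a c e) (ℤₚ.+-assoc b d f)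

⊖-self : ∀ x → x ⊖ x ≡ 0φ
⊖-self (mk a b) = cong₂ mk (ℤₚ.+-inverseʳ a) (ℤₚ.+-inverseʳ b)

⊗-identityˡ : ∀ x → 1φ ⊗ x ≡ x
⊗-identityˡ (mk a b) = cong₂ mk (re-eq a b) (im-eq a b)
  where
  re-eq : ∀ a b → + 1 ℤ.* a ℤ.+ + 0 ℤ.* b ≡ a
  re-eq = solve-∀
  im-eq : ∀ a b → + 1 ℤ.* b ℤ.+ + 0 ℤ.* a ℤ.+ + 0 ℤ.* b ≡ b
  im-eq = solve-∀

⊗-zeroʳ : ∀ x → x ⊗ 0φ ≡ 0φ
⊗-zeroʳ (mk a b) = cong₂ mk (re-eq a b) (im-eq a b)
  where
  re-eq : ∀ a b → a ℤ.* + 0 ℤ.+ b ℤ.* + 0 ≡ + 0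
  re-eq = solve-∀
  im-eq : ∀ a b → a ℤ.* + 0 ℤ.+ b ℤ.* + 0 ℤ.+ b ℤ.* + 0 ≡ + 0
  im-eq = solve-∀

⊗-comm : ∀ x y → x ⊗ y ≡ y ⊗ x
⊗-comm (mk a b) (mk c d) = cong₂ mk (re-eq a b c d) (im-eq a b c d)
  where
  re-eq : ∀ a b c d → a ℤ.* c ℤ.+ b ℤ.* d ≡ c ℤ.* a ℤ.+ d ℤ.* b
  re-eq = solve-∀
  im-eq : ∀ a b c d → a ℤ.* d ℤ.+ b ℤ.* c ℤ.+ b ℤ.* d ≡ c ℤ.* b ℤ.+ d ℤ.* a ℤ.+ d ℤ.* b
  im-eq = solve-∀

⊗-zeroˡ : ∀ x → 0φ ⊗ x ≡ 0φ
⊗-zeroˡ x = trans (⊗-comm 0φ x) (⊗-zeroʳ x)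

⊗-assoc : ∀ x y z → (x ⊗ y) ⊗ z ≡ x ⊗ (y ⊗ z)
⊗-assoc (mk a b) (mk c d) (mk e f) = cong₂ mk (re-eq a b c d e f) (im-eq a b c d e f)
  where
  re-eq : ∀ a b c d e f →
    (a ℤ.* c ℤ.+ b ℤ.* d) ℤ.* e ℤ.+ (a ℤ.* d ℤ.+ b ℤ.* c ℤ.+ b ℤ.* d) ℤ.* f
    ≡ a ℤ.* (c ℤ.* e ℤ.+ d ℤ.* f) ℤ.+ b ℤ.* (c ℤ.* f ℤ.+ d ℤ.* e ℤ.+ d ℤ.* f)
  re-eq = solve-∀
  im-eq : ∀ a b c d e f →
    (a ℤ.* c ℤ.+ b ℤ.* d) ℤ.* f ℤ.+ (a ℤ.* d ℤ.+ b ℤ.* c ℤ.+ b ℤ.* d) ℤ.* e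
      ℤ.+ (a ℤ.* d ℤ.+ b ℤ.* c ℤ.+ b ℤ.* d) ℤ.* f
    ≡ a ℤ.* (c ℤ.* f ℤ.+ d ℤ.* e ℤ.+ d ℤ.* f) ℤ.+ b ℤ.* (c ℤ.* e ℤ.+ d ℤ.* f)
      ℤ.+ b ℤ.* (c ℤ.* f ℤ.+ d ℤ.* e ℤ.+ d ℤ.* f)
  im-eq = solve-∀

⊗-distribˡ-⊕ : ∀ x y z → x ⊗ (y ⊕ z) ≡ (x ⊗ y) ⊕ (x ⊗ z)
⊗-distribˡ-⊕ (mk a b) (mk c d) (mk e f) = cong₂ mk (re-eq a b c d e f) (im-eq a b c d e f)
  where
  re-eq : ∀ a b c d e f → a ℤ.* (c ℤ.+ e) ℤ.+ b ℤ.* (d ℤ.+ f)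
                     ≡ (a ℤ.* c ℤ.+ b ℤ.* d) ℤ.+ (a ℤ.* e ℤ.+ b ℤ.* f)
  re-eq = solve-∀
  im-eq : ∀ a b c d e f → a ℤ.* (d ℤ.+ f) ℤ.+ b ℤ.* (c ℤ.+ e) ℤ.+ b ℤ.* (d ℤ.+ f)
                      ≡ (a ℤ.* d ℤ.+ b ℤ.* c ℤ.+ b ℤ.* d) ℤ.+ (a ℤ.* f ℤ.+ b ℤ.* e ℤ.+ b ℤ.* f)
  im-eq = solve-∀

⊗-distribʳ-⊕ : ∀ x y z → (x ⊕ y) ⊗ z ≡ (x ⊗ z) ⊕ (y ⊗ z)
⊗-distribʳ-⊕ x y z = begin
  (x ⊕ y) ⊗ z          ≡⟨ ⊗-comm (x ⊕ y) z ⟩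
  z ⊗ (x ⊕ y)          ≡⟨ ⊗-distribˡ-⊕ z x y ⟩
  (z ⊗ x) ⊕ (z ⊗ y)    ≡⟨ cong₂ _⊕_ (⊗-comm z x) (⊗-comm z y) ⟩
  (x ⊗ z) ⊕ (y ⊗ z)    ∎
  where open ≡-Reasoning

⊗-commutativeSemigroup : CommutativeSemigroup _ _
⊗-commutativeSemigroup = record
  { _≈_ = _≡_
  ; _∙_ = _⊗_
  ; isCommutativeSemigroup = record
    { isSemigroup = record
      { isMagma = record { isEquivalence = isEquivalence ; ∙-cong = cong₂ _⊗_ }
      ; assoc = ⊗-assoc
      }
    ; comm = ⊗-comm
    }
  }

open import Algebra.Properties.CommutativeSemigroup ⊗-commutativeSemigroup
  using () renaming (interchange to ⊗-interchange)

^φ-+ : ∀ x m n → x ^φ (m + n) ≡ (x ^φ m) ⊗ (x ^φ n)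
^φ-+ x zero    n = sym (⊗-identityˡ (x ^φ n))
^φ-+ x (suc m) n = trans (cong (x ⊗_) (^φ-+ x m n)) (sym (⊗-assoc x (x ^φ m) (x ^φ n)))

cube : Zφ → Zφ
cube a = a ⊗ (a ⊗ a)

cube-⊗ : ∀ x y → cube (x ⊗ y) ≡ cube x ⊗ cube y
cube-⊗ x y = trans (cong ((x ⊗ y) ⊗_) (⊗-interchange x y x y))
                   (⊗-interchange x y (x ⊗ x) (y ⊗ y))

natφ : ℕ → Zφ
natφ k = mk (+ k) (+ 0)

natφ-* : ∀ m n → natφ (m * n) ≡ natφ m ⊗ natφ n
natφ-* m n = cong₂ mk (trans (ℤₚ.pos-* m n) (sym (ℤₚ.+-identityʳ (+ m ℤ.* + n))))
                      (im-eq (+ m) (+ n))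
  where
  im-eq : ∀ p q → + 0 ≡ p ℤ.* + 0 ℤ.+ + 0 ℤ.* q ℤ.+ + 0 ℤ.* + 0
  im-eq = solve-∀

trace : Zφ → ℤ
trace (mk a b) = + 2 ℤ.* a ℤ.+ b

norm : Zφ → ℤ
norm (mk a b) = a ℤ.* a ℤ.+ a ℤ.* b ℤ.- b ℤ.* b

trace²≡5im²+4norm : ∀ x → trace x ℤ.* trace x ≡ + 5 ℤ.* (im x ℤ.* im x) ℤ.+ + 4 ℤ.* norm x
trace²≡5im²+4norm (mk a b) = eq a b
  where
  eq : ∀ a b → (+ 2 ℤ.* a ℤ.+ b) ℤ.* (+ 2 ℤ.* a ℤ.+ b)
             ≡ + 5 ℤ.* (b ℤ.* b) ℤ.+ + 4 ℤ.* (a ℤ.* a ℤ.+ a ℤ.* b ℤ.- b ℤ.* b)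
  eq = solve-∀

norm-⊗ : ∀ x y → norm (x ⊗ y) ≡ norm x ℤ.* norm y
norm-⊗ (mk a b) (mk c d) = eq a b c d
  where
  eq : ∀ a b c d →
    (a ℤ.* c ℤ.+ b ℤ.* d) ℤ.* (a ℤ.* c ℤ.+ b ℤ.* d)
      ℤ.+ (a ℤ.* c ℤ.+ b ℤ.* d) ℤ.* (a ℤ.* d ℤ.+ b ℤ.* c ℤ.+ b ℤ.* d)
      ℤ.- (a ℤ.* d ℤ.+ b ℤ.* c ℤ.+ b ℤ.* d) ℤ.* (a ℤ.* d ℤ.+ b ℤ.* c ℤ.+ b ℤ.* d)
    ≡ (a ℤ.* a ℤ.+ a ℤ.* b ℤ.- b ℤ.* b) ℤ.* (c ℤ.* c ℤ.+ c ℤ.* d ℤ.- d ℤ.* d)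
  eq = solve-∀

trace-natφ-⊗ : ∀ k x → trace (natφ k ⊗ x) ≡ + k ℤ.* trace x
trace-natφ-⊗ k (mk a b) = eq (+ k) a b
  where
  eq : ∀ k a b → + 2 ℤ.* (k ℤ.* a ℤ.+ + 0 ℤ.* b) ℤ.+ (k ℤ.* b ℤ.+ + 0 ℤ.* a ℤ.+ + 0 ℤ.* b)
               ≡ k ℤ.* (+ 2 ℤ.* a ℤ.+ b)
  eq = solve-∀

im-natφ-⊗ : ∀ k x → im (natφ k ⊗ x) ≡ + k ℤ.* im x
im-natφ-⊗ k (mk a b) = eq (+ k) a b
  where
  eq : ∀ k a b → k ℤ.* b ℤ.+ + 0 ℤ.* a ℤ.+ + 0 ℤ.* b ≡ k ℤ.* b
  eq = solve-∀

norm-natφ-⊗ : ∀ k x → norm (natφ k ⊗ x) ≡ + k ℤ.* (+ k ℤ.* norm x)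
norm-natφ-⊗ k x = begin
  norm (natφ k ⊗ x)                   ≡⟨ norm-⊗ (natφ k) x ⟩
  norm (natφ k) ℤ.* norm x            ≡⟨ cong (ℤ._* norm x) (norm-natφ (+ k)) ⟩
  (+ k ℤ.* + k) ℤ.* norm x            ≡⟨ ℤₚ.*-assoc (+ k) (+ k) (norm x) ⟩
  + k ℤ.* (+ k ℤ.* norm x)            ∎
  where
  open ≡-Reasoning
  norm-natφ : ∀ k → k ℤ.* k ℤ.+ k ℤ.* + 0 ℤ.- + 0 ℤ.* + 0 ≡ k ℤ.* k
  norm-natφ = solve-∀

i<i+j : ∀ i {j} → + 0 ℤ.< j → i ℤ.< i ℤ.+ j
i<i+j i 0<j = subst (ℤ._< i ℤ.+ _) (ℤₚ.+-identityʳ i) (ℤₚ.+-monoʳ-< i 0<j)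

i+j<i : ∀ i {j} → j ℤ.< + 0 → i ℤ.+ j ℤ.< i
i+j<i i j<0 = subst (i ℤ.+ _ ℤ.<_) (ℤₚ.+-identityʳ i) (ℤₚ.+-monoʳ-< i j<0)

suc*-pos : ∀ k {i} → + 0 ℤ.< i → + 0 ℤ.< + suc k ℤ.* i
suc*-pos k {i} 0<i =
  subst (ℤ._< + suc k ℤ.* i) (ℤₚ.*-zeroʳ (+ suc k)) (ℤₚ.*-monoˡ-<-pos (+ suc k) 0<i)

suc*-neg : ∀ k {i} → i ℤ.< + 0 → + suc k ℤ.* i ℤ.< + 0
suc*-neg k {i} i<0 =
  subst (+ suc k ℤ.* i ℤ.<_) (ℤₚ.*-zeroʳ (+ suc k)) (ℤₚ.*-monoˡ-<-pos (+ suc k) i<0)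

-- trace x and norm x are the sum and the product of x = a + bφ and its conjugate x′ = a + bφ′,
-- and x − x′ = b√5; either pattern forces x > 0 (x′ > 0 in the first, x′ < 0 in the second).
data PositiveBySign (x : Zφ) : Set where
  totally-positive   : + 0 ℤ.< trace x → + 0 ℤ.< norm x → PositiveBySign x
  conjugate-negative : + 0 ℤ.< im x → norm x ℤ.< + 0 → PositiveBySign x

positiveBySign⇒Positive : ∀ {x} → PositiveBySign x → Positive x
positiveBySign⇒Positive {mk a b} (totally-positive 0<t 0<n) with b ℤₚ.<? + 0
... | no  b≮0 = pos-nonneg (ℤₚ.<⇒≤ 0<t) (ℤₚ.≮⇒≥ b≮0) λ (t≡0 , _) → ℤₚ.<⇒≢ 0<t (sym t≡0)
... | yes b<0 = pos-bneg 0<t b<0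
  (subst (_ ℤ.<_) (sym (trace²≡5im²+4norm (mk a b)))
         (i<i+j _ (ℤₚ.*-monoˡ-<-pos (+ 4) 0<n)))
positiveBySign⇒Positive {mk a b} (conjugate-negative 0<b n<0) with trace (mk a b) ℤₚ.<? + 0
... | no  t≮0 = pos-nonneg (ℤₚ.≮⇒≥ t≮0) (ℤₚ.<⇒≤ 0<b) λ (_ , b≡0) → ℤₚ.<⇒≢ 0<b (sym b≡0)
... | yes t<0 = pos-xneg t<0 0<b
  (subst (ℤ._< _) (sym (trace²≡5im²+4norm (mk a b)))
         (i+j<i _ (ℤₚ.*-monoˡ-<-pos (+ 4) n<0)))

positiveBySign-natφ-⊗ : ∀ k {x} → PositiveBySign x → PositiveBySign (natφ (suc k) ⊗ x)
positiveBySign-natφ-⊗ k {x} (totally-positive 0<t 0<n) = totally-positive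
  (subst (+ 0 ℤ.<_) (sym (trace-natφ-⊗ (suc k) x)) (suc*-pos k 0<t))
  (subst (+ 0 ℤ.<_) (sym (norm-natφ-⊗ (suc k) x)) (suc*-pos k (suc*-pos k 0<n)))
positiveBySign-natφ-⊗ k {x} (conjugate-negative 0<b n<0) = conjugate-negative
  (subst (+ 0 ℤ.<_) (sym (im-natφ-⊗ (suc k) x)) (suc*-pos k 0<b))
  (subst (ℤ._< + 0) (sym (norm-natφ-⊗ (suc k) x)) (suc*-neg k (suc*-neg k n<0)))

fib : ℕ → ℕ
fib zero          = 0
fib (suc zero)    = 1
fib (suc (suc n)) = fib n + fib (suc n)

1≤fib-suc : ∀ n → 1 ≤ fib (suc n)
1≤fib-suc zero    = s≤s z≤n
1≤fib-suc (suc n) = ℕₚ.≤-trans (1≤fib-suc n) (ℕₚ.m≤n+m (fib (suc n)) (fib n))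

-1^-cases : ∀ j → -1ℤ ℤ.^ j ≡ 1ℤ ⊎ -1ℤ ℤ.^ j ≡ -1ℤ
-1^-cases zero = inj₁ refl
-1^-cases (suc j) with -1^-cases j
... | inj₁ s≡1  = inj₂ (cong (-1ℤ ℤ.*_) s≡1)
... | inj₂ s≡-1 = inj₁ (cong (-1ℤ ℤ.*_) s≡-1)

-1^≢0 : ∀ j → -1ℤ ℤ.^ j ≢ + 0
-1^≢0 j with -1ℤ ℤ.^ j | -1^-cases j
... | _ | inj₁ refl = λ ()
... | _ | inj₂ refl = λ ()

invφ^-closed : ∀ j → invφ ^φ j ≡ mk (-1ℤ ℤ.^ j ℤ.* + fib (suc j)) (ℤ.- (-1ℤ ℤ.^ j ℤ.* + fib j))
invφ^-closed zero    = refl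
invφ^-closed (suc j) = begin
  invφ ⊗ (invφ ^φ j)
    ≡⟨ cong (invφ ⊗_) (invφ^-closed j) ⟩
  invφ ⊗ mk (-1ℤ ℤ.^ j ℤ.* + fib (suc j)) (ℤ.- (-1ℤ ℤ.^ j ℤ.* + fib j))
    ≡⟨ cong₂ mk (re-eq (-1ℤ ℤ.^ j) (+ fib j) (+ fib (suc j)))
                (im-eq (-1ℤ ℤ.^ j) (+ fib j) (+ fib (suc j))) ⟩
  mk (-1ℤ ℤ.^ suc j ℤ.* + fib (suc (suc j))) (ℤ.- (-1ℤ ℤ.^ suc j ℤ.* + fib (suc j)))
    ∎
  where
  open ≡-Reasoning
  re-eq : ∀ s f g → ℤ.- + 1 ℤ.* (s ℤ.* g) ℤ.+ + 1 ℤ.* ℤ.- (s ℤ.* f)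
                  ≡ (ℤ.- + 1 ℤ.* s) ℤ.* (f ℤ.+ g)
  re-eq = solve-∀
  im-eq : ∀ s f g → ℤ.- + 1 ℤ.* ℤ.- (s ℤ.* f) ℤ.+ + 1 ℤ.* (s ℤ.* g) ℤ.+ + 1 ℤ.* ℤ.- (s ℤ.* f)
                  ≡ ℤ.- ((ℤ.- + 1 ℤ.* s) ℤ.* g)
  im-eq = solve-∀

im-invφ^ : ∀ j → im (invφ ^φ j) ≡ ℤ.- (-1ℤ ℤ.^ j ℤ.* + fib j)
im-invφ^ j = cong im (invφ^-closed j)

trace-invφ^-suc : ∀ j → trace (invφ ^φ suc j) ≡ -1ℤ ℤ.^ suc j ℤ.* + (fib j + fib j + fib (suc j))
trace-invφ^-suc j =
  trans (cong trace (invφ^-closed (suc j))) (eq (-1ℤ ℤ.^ suc j) (+ fib j) (+ fib (suc j)))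
  where
  eq : ∀ s f g → + 2 ℤ.* (s ℤ.* (f ℤ.+ g)) ℤ.+ ℤ.- (s ℤ.* g) ≡ s ℤ.* (f ℤ.+ f ℤ.+ g)
  eq = solve-∀

norm-invφ^ : ∀ j → norm (invφ ^φ j) ≡ -1ℤ ℤ.^ j
norm-invφ^ zero    = refl
norm-invφ^ (suc j) = trans (norm-⊗ invφ (invφ ^φ j)) (cong (-1ℤ ℤ.*_) (norm-invφ^ j))

0<trace-invφ^-suc : ∀ j → -1ℤ ℤ.^ suc j ≡ 1ℤ → + 0 ℤ.< trace (invφ ^φ suc j)
0<trace-invφ^-suc j s≡1
  rewrite trace-invφ^-suc j | s≡1 | ℤₚ.*-identityˡ (+ (fib j + fib j + fib (suc j))) =
  +<+ (ℕₚ.≤-trans (1≤fib-suc j) (ℕₚ.m≤n+m (fib (suc j)) (fib j + fib j)))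

0<im-invφ^ : ∀ j → -1ℤ ℤ.^ j ≡ -1ℤ → 1 ≤ fib j → + 0 ℤ.< im (invφ ^φ j)
0<im-invφ^ j s≡-1 1≤F
  rewrite im-invφ^ j | s≡-1 | ℤₚ.-1*i≡-i (+ fib j) | ℤₚ.neg-involutive (+ fib j) = +<+ 1≤F

positiveBySign-invφ^ : ∀ j → PositiveBySign (invφ ^φ j)
positiveBySign-invφ^ zero = totally-positive (+<+ (s≤s z≤n)) (+<+ (s≤s z≤n))
positiveBySign-invφ^ (suc j) with -1^-cases (suc j)
... | inj₁ s≡1  = totally-positive (0<trace-invφ^-suc j s≡1)
  (subst (+ 0 ℤ.<_) (sym (trans (norm-invφ^ (suc j)) s≡1)) (+<+ (s≤s z≤n)))
... | inj₂ s≡-1 = conjugate-negative (0<im-invφ^ (suc j) s≡-1 (1≤fib-suc j))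
  (subst (ℤ._< + 0) (sym (trans (norm-invφ^ (suc j)) s≡-1)) -<+)

im-invφ^-suc≢0 : ∀ j → im (invφ ^φ suc j) ≢ + 0
im-invφ^-suc≢0 j im≡0
  with ℤₚ.i*j≡0⇒i≡0∨j≡0 (-1ℤ ℤ.^ suc j) (ℤₚ.neg-injective (trans (sym (im-invφ^ (suc j))) im≡0))
... | inj₁ s≡0 = -1^≢0 (suc j) s≡0
... | inj₂ F≡0 = ℕₚ.<⇒≢ (1≤fib-suc j) (sym (ℤₚ.+-injective F≡0))

Monomial : Set
Monomial = ℕ × ℕ

-- Coefficients are written 1 + a so that they are positive by construction.
monomial : Monomial → Zφ
monomial (a , j) = natφ (suc a) ⊗ (invφ ^φ j)

-- (1 + a)(1 + b) = 1 + (b + a(1 + b)), the form to which suc a * suc b reduces.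
_⊠_ : Monomial → Monomial → Monomial
(a , j) ⊠ (b , k) = (b + a * suc b , j + k)

monomial-⊠ : ∀ m n → monomial (m ⊠ n) ≡ monomial m ⊗ monomial n
monomial-⊠ (a , j) (b , k) = begin
  natφ (suc a * suc b) ⊗ (invφ ^φ (j + k))
    ≡⟨ cong₂ _⊗_ (natφ-* (suc a) (suc b)) (^φ-+ invφ j k) ⟩
  (natφ (suc a) ⊗ natφ (suc b)) ⊗ ((invφ ^φ j) ⊗ (invφ ^φ k))
    ≡⟨ ⊗-interchange (natφ (suc a)) (natφ (suc b)) (invφ ^φ j) (invφ ^φ k) ⟩
  monomial (a , j) ⊗ monomial (b , k)
    ∎
  where open ≡-Reasoning

monomial-positive : ∀ m → Positive (monomial m)
monomial-positive (a , j) =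
  positiveBySign⇒Positive (positiveBySign-natφ-⊗ a (positiveBySign-invφ^ j))

im-monomial-zero : ∀ a → im (monomial (a , 0)) ≡ + 0
im-monomial-zero a = trans (im-natφ-⊗ (suc a) 1φ) (ℤₚ.*-zeroʳ (+ suc a))

im-monomial-suc≢0 : ∀ a j → im (monomial (a , suc j)) ≢ + 0
im-monomial-suc≢0 a j im≡0
  with ℤₚ.i*j≡0⇒i≡0∨j≡0 (+ suc a) (trans (sym (im-natφ-⊗ (suc a) (invφ ^φ suc j))) im≡0)
... | inj₁ ()
... | inj₂ im′≡0 = im-invφ^-suc≢0 j im′≡0

monomial-coeff1 : ∀ n → monomial (0 , n) ≡ invφ ^φ n
monomial-coeff1 n = ⊗-identityˡ (invφ ^φ n)

map-cartesianProductWith : ∀ {A B : Set} {f : A → A → A} {g : B → B → B} (h : A → B) →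
  (∀ x y → h (f x y) ≡ g (h x) (h y)) → ∀ xs ys →
  map h (cartesianProductWith f xs ys) ≡ cartesianProductWith g (map h xs) (map h ys)
map-cartesianProductWith h hom []       ys = refl
map-cartesianProductWith {f = f} {g} h hom (x ∷ xs) ys = begin
  map h (map (f x) ys ++ cartesianProductWith f xs ys)
    ≡⟨ map-++ h (map (f x) ys) _ ⟩
  map h (map (f x) ys) ++ map h (cartesianProductWith f xs ys)
    ≡⟨ cong₂ _++_ map-hom (map-cartesianProductWith h hom xs ys) ⟩
  map (g (h x)) (map h ys) ++ cartesianProductWith g (map h xs) (map h ys)
    ∎
  where
  open ≡-Reasoning
  map-hom : map h (map (f x) ys) ≡ map (g (h x)) (map h ys)
  map-hom = trans (sym (map-∘ ys)) (trans (map-cong (hom x) ys) (map-∘ ys))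

length-cartesianProductWith : ∀ {A B C : Set} (f : A → B → C) xs ys →
  length (cartesianProductWith f xs ys) ≡ length xs * length ys
length-cartesianProductWith f []       ys = refl
length-cartesianProductWith f (x ∷ xs) ys =
  trans (length-++ (map (f x) ys))
        (cong₂ _+_ (length-map (f x) ys) (length-cartesianProductWith f xs ys))

sumφ-++ : ∀ xs ys → sumφ (xs ++ ys) ≡ sumφ xs ⊕ sumφ ys
sumφ-++ []       ys = sym (⊕-identityˡ (sumφ ys))
sumφ-++ (x ∷ xs) ys = trans (cong (x ⊕_) (sumφ-++ xs ys)) (sym (⊕-assoc x (sumφ xs) (sumφ ys)))

sumφ-map-⊗ : ∀ x ys → sumφ (map (x ⊗_) ys) ≡ x ⊗ sumφ ys
sumφ-map-⊗ x []       = sym (⊗-zeroʳ x)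
sumφ-map-⊗ x (y ∷ ys) =
  trans (cong ((x ⊗ y) ⊕_) (sumφ-map-⊗ x ys)) (sym (⊗-distribˡ-⊕ x y (sumφ ys)))

sumφ-cartesianProduct : ∀ xs ys → sumφ (cartesianProductWith _⊗_ xs ys) ≡ sumφ xs ⊗ sumφ ys
sumφ-cartesianProduct []       ys = sym (⊗-zeroˡ (sumφ ys))
sumφ-cartesianProduct (x ∷ xs) ys = begin
  sumφ (map (x ⊗_) ys ++ cartesianProductWith _⊗_ xs ys)
    ≡⟨ sumφ-++ (map (x ⊗_) ys) _ ⟩
  sumφ (map (x ⊗_) ys) ⊕ sumφ (cartesianProductWith _⊗_ xs ys)
    ≡⟨ cong₂ _⊕_ (sumφ-map-⊗ x ys) (sumφ-cartesianProduct xs ys) ⟩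
  (x ⊗ sumφ ys) ⊕ (sumφ xs ⊗ sumφ ys)
    ≡⟨ sym (⊗-distribʳ-⊕ x (sumφ xs) (sumφ ys)) ⟩
  (x ⊕ sumφ xs) ⊗ sumφ ys
    ∎
  where open ≡-Reasoning

cubeSum : List Zφ → Zφ
cubeSum xs = sumφ (map cube xs)

Balanced : List Zφ → Set
Balanced xs = sumφ xs ⊗ sumφ xs ≡ cubeSum xs

ν-balanced : ∀ xs → Balanced xs → ν xs ≡ 0φ
ν-balanced xs balanced = trans (cong (_⊖ cubeSum xs) balanced) (⊖-self (cubeSum xs))

balanced-cartesianProduct : ∀ xs ys → Balanced xs → Balanced ys →
  Balanced (cartesianProductWith _⊗_ xs ys)
balanced-cartesianProduct xs ys bx by = begin
  sumφ xys ⊗ sumφ xys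
    ≡⟨ cong₂ _⊗_ (sumφ-cartesianProduct xs ys) (sumφ-cartesianProduct xs ys) ⟩
  (sumφ xs ⊗ sumφ ys) ⊗ (sumφ xs ⊗ sumφ ys)
    ≡⟨ ⊗-interchange (sumφ xs) (sumφ ys) (sumφ xs) (sumφ ys) ⟩
  (sumφ xs ⊗ sumφ xs) ⊗ (sumφ ys ⊗ sumφ ys)
    ≡⟨ cong₂ _⊗_ bx by ⟩
  cubeSum xs ⊗ cubeSum ys
    ≡⟨ sym (sumφ-cartesianProduct (map cube xs) (map cube ys)) ⟩
  sumφ (cartesianProductWith _⊗_ (map cube xs) (map cube ys))
    ≡⟨ cong sumφ (sym (map-cartesianProductWith {f = _⊗_} {g = _⊗_} cube cube-⊗ xs ys)) ⟩
  cubeSum xys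
    ∎
  where
  open ≡-Reasoning
  xys = cartesianProductWith _⊗_ xs ys

rationalCount : List Monomial → ℕ
rationalCount []                 = 0
rationalCount ((_ , zero)  ∷ ms) = suc (rationalCount ms)
rationalCount ((_ , suc _) ∷ ms) = rationalCount ms

rationalCount-++ : ∀ ms ns → rationalCount (ms ++ ns) ≡ rationalCount ms + rationalCount ns
rationalCount-++ []                 ns = refl
rationalCount-++ ((_ , zero)  ∷ ms) ns = cong suc (rationalCount-++ ms ns)
rationalCount-++ ((_ , suc _) ∷ ms) ns = rationalCount-++ ms ns

rationalCount-map-rational⊠ : ∀ a ns → rationalCount (map ((a , 0) ⊠_) ns) ≡ rationalCount ns
rationalCount-map-rational⊠ a []                 = refl
rationalCount-map-rational⊠ a ((_ , zero)  ∷ ns) = cong suc (rationalCount-map-rational⊠ a ns)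
rationalCount-map-rational⊠ a ((_ , suc _) ∷ ns) = rationalCount-map-rational⊠ a ns

rationalCount-map-irrational⊠ : ∀ a j ns → rationalCount (map ((a , suc j) ⊠_) ns) ≡ 0
rationalCount-map-irrational⊠ a j []       = refl
rationalCount-map-irrational⊠ a j (_ ∷ ns) = rationalCount-map-irrational⊠ a j ns

rationalCount-cartesianProduct : ∀ ms ns →
  rationalCount (cartesianProductWith _⊠_ ms ns) ≡ rationalCount ms * rationalCount ns
rationalCount-cartesianProduct [] ns = refl
rationalCount-cartesianProduct ((a , zero) ∷ ms) ns =
  trans (rationalCount-++ (map ((a , 0) ⊠_) ns) (cartesianProductWith _⊠_ ms ns))
        (cong₂ _+_ (rationalCount-map-rational⊠ a ns) (rationalCount-cartesianProduct ms ns))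
rationalCount-cartesianProduct ((a , suc j) ∷ ms) ns =
  trans (rationalCount-++ (map ((a , suc j) ⊠_) ns) (cartesianProductWith _⊠_ ms ns))
        (cong₂ _+_ (rationalCount-map-irrational⊠ a j ns) (rationalCount-cartesianProduct ms ns))

irrCount-map-monomial : ∀ ms → irrCount (map monomial ms) + rationalCount ms ≡ length ms
irrCount-map-monomial [] = refl
irrCount-map-monomial ((a , zero) ∷ ms) with im (monomial (a , zero)) ℤ.≟ + 0
... | yes _      = trans (ℕₚ.+-suc _ (rationalCount ms)) (cong suc (irrCount-map-monomial ms))
... | no  im≢0   = ⊥-elim (im≢0 (im-monomial-zero a))
irrCount-map-monomial ((a , suc j) ∷ ms) with im (monomial (a , suc j)) ℤ.≟ + 0
... | yes im≡0   = ⊥-elim (im-monomial-suc≢0 a j im≡0)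
... | no  _      = cong suc (irrCount-map-monomial ms)

-- φ⁻¹, 1, 2φ⁻¹, 3φ⁻¹, 3, 5: the sum is 3 + 6φ, whose square 45 + 72φ is also the sum of
-- cubes 153 + 36φ⁻³.
generators : List Monomial
generators = (0 , 1) ∷ (0 , 0) ∷ (1 , 1) ∷ (2 , 1) ∷ (2 , 0) ∷ (4 , 0) ∷ []

powers : ℕ → List Monomial
powers zero    = (0 , 0) ∷ []
powers (suc m) = cartesianProductWith _⊠_ generators (powers m)

witness : ℕ → List Zφ
witness m = map monomial (powers m)

witness-positive : ∀ m → All Positive (witness m)
witness-positive m = map⁺ (universal monomial-positive (powers m))

witness-balanced : ∀ m → Balanced (witness m)
witness-balanced zero    = refl
witness-balanced (suc m) =
  subst Balanced
    (sym (map-cartesianProductWith {f = _⊠_} {g = _⊗_} monomial monomial-⊠ generators (powers m)))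
        (balanced-cartesianProduct (map monomial generators) (witness m) refl (witness-balanced m))

length-powers : ∀ m → length (powers m) ≡ 6 ^ m
length-powers zero    = refl
length-powers (suc m) =
  trans (length-cartesianProductWith _⊠_ generators (powers m)) (cong (6 *_) (length-powers m))

rationalCount-powers : ∀ m → rationalCount (powers m) ≡ 3 ^ m
rationalCount-powers zero    = refl
rationalCount-powers (suc m) =
  trans (rationalCount-cartesianProduct generators (powers m))
        (cong (3 *_) (rationalCount-powers m))

2*3^<6^ : ∀ n → 2 * 3 ^ (2 + n) < 6 ^ (2 + n)
2*3^<6^ n = begin-strict
  2 * 3 ^ (2 + n)  ≡⟨ eq₁ (3 ^ n) ⟩
  18 * 3 ^ n       <⟨ ℕₚ.*-monoˡ-< (3 ^ n) {{ℕₚ.m^n≢0 3 n}} (ℕₚ.m≤n+m 19 17) ⟩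
  36 * 3 ^ n       ≤⟨ ℕₚ.*-monoʳ-≤ 36 (ℕₚ.^-monoˡ-≤ n (ℕₚ.m≤n+m 3 3)) ⟩
  36 * 6 ^ n       ≡⟨ eq₂ (6 ^ n) ⟨
  6 ^ (2 + n)      ∎
  where
  open ℕₚ.≤-Reasoning
  eq₁ : ∀ x → 2 * (3 * (3 * x)) ≡ 18 * x
  eq₁ = ℕ-Solver.solve-∀
  eq₂ : ∀ x → 6 * (6 * x) ≡ 36 * x
  eq₂ = ℕ-Solver.solve-∀

majority : ∀ {i r l} → i + r ≡ l → 2 * r < l → l < 2 * i
majority {i} {r} refl 2r<l =
  subst (i + r <_) (cong (λ k → i + k) (sym (ℕₚ.+-identityʳ i))) (ℕₚ.+-monoʳ-< i r<i)
  where
  r<i : r < i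
  r<i = ℕₚ.+-cancelʳ-< r r i (subst (_< i + r) (cong (λ k → r + k) (ℕₚ.+-identityʳ r)) 2r<l)

witness-irrational-majority : ∀ n → length (witness (2 + n)) < 2 * irrCount (witness (2 + n))
witness-irrational-majority n =
  subst (_< 2 * irrCount (witness m)) (sym (length-map monomial (powers m)))
    (majority {irrCount (witness m)} (irrCount-map-monomial (powers m))
      (subst₂ (λ r l → 2 * r < l) (sym (rationalCount-powers m)) (sym (length-powers m))
              (2*3^<6^ n)))
  where m = 2 + n

coeff1-∈-powers : ∀ {n m} → n ≤ m → (0 , n) ∈ powers m
coeff1-∈-powers {m = zero}  z≤n     = here refl
coeff1-∈-powers {m = suc m} z≤n =
  ∈-cartesianProductWith⁺ _⊠_ {generators} {powers m} {0 , 0}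
    (there (here refl)) (coeff1-∈-powers {m = m} z≤n)
coeff1-∈-powers {m = suc m} (s≤s n≤m) =
  ∈-cartesianProductWith⁺ _⊠_ {generators} {powers m} {0 , 1} (here refl) (coeff1-∈-powers n≤m)

invφ^-∈-witness : ∀ {n m} → n ≤ m → invφ ^φ n ∈ witness m
invφ^-∈-witness {n} {m} n≤m =
  subst (_∈ witness m) (monomial-coeff1 n) (∈-map⁺ monomial (coeff1-∈-powers n≤m))

mainTheorem15 :
    Σ (List Zφ) (λ σ → All Positive σ × length σ < 2 * irrCount σ × ν σ ≡ 0φ)
    × ((N : ℕ) → 0 < N →
        Σ (List Zφ) (λ σ → All Positive σ × length σ < 2 * irrCount σ × ν σ ≡ 0φ
          × ((n : ℕ) → 1 ≤ n → n ≤ N → (invφ ^φ n) ∈ σ)))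
mainTheorem15 =
  (witness 2 , witness-positive 2 , witness-irrational-majority 0 ,
   ν-balanced (witness 2) (witness-balanced 2)) ,
  λ { (suc N) _ → witness (2 + N) , witness-positive (2 + N) , witness-irrational-majority N ,
                  ν-balanced (witness (2 + N)) (witness-balanced (2 + N)) ,
                  λ n _ n≤1+N → invφ^-∈-witness (ℕₚ.m≤n⇒m≤1+n n≤1+N) }
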